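{- For every $n\ge1$ and $\mu\in\mathrm{WComp}_{n-1}$ there is a bijection between $\mathsf{Lyn}_\mu$ and $\mathsf{Comb}_\mu$.
   Context: $\mathrm{WComp}_{n-1}$: weak compositions with sum $n-1$. Labeled colored binary trees on $[n]$: planar rooted binary trees (internal node $x$ has left child $L(x)$, right child $R(x)$) with leaves labeled bijectively by $[n]$ and internal nodes colored in $\mathbb{P}$. Valency $v(x)$: smallest leaf label below $x$. Normalized: $v(x)=v(L(x))$ for every internal $x$. An internal node $x$ is a Lyndon node if $L(x)$ is a leaf or $v(R(L(x)))>v(R(x))$. A colored Lyndon tree is normalized with $\mathrm{color}(L(x))>\mathrm{color}(x)$ for every non-Lyndon internal node $x$. A colored comb is a normalized labeled colored binary tree such that for each internal node $x$ whose right child $R(x)$ is not a leaf, $\mathrm{color}(x)>\mathrm{color}(R(x))$. $\mathsf{Lyn}_\mu$ (resp. $\mathsf{Comb}_\mu$) is the set of colored Lyndon trees (resp. colored combs) on $[n]$ with exactly $\mu(j)$ internal nodes of color $j$ for each $j$. -}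

module Defs where

open import Data.Bool using (Bool; true; false; _∧_; _∨_; not; T)
open import Data.Nat using (ℕ; zero; suc; _⊓_; _<ᵇ_; _≡ᵇ_)
open import Data.List using (List; []; _∷_; _++_; length; map; upTo)
open import Data.Bool.ListAction using (all; any)
open import Data.Product using (Σ)

-- Planar rooted binary trees: leaves carry a label (a natural number),
-- internal nodes carry a colour (a natural number; positivity is checked
-- separately) and have a left and a right child.
data Tree : Set where
  leaf : ℕ → Tree
  node : (colour : ℕ) → (left right : Tree) → Tree

leaves : Tree → List ℕ
leaves (leaf i) = i ∷ []
leaves (node c l r) = leaves l ++ leaves r

colours : Tree → List ℕ
colours (leaf i) = []
colours (node c l r) = c ∷ colours l ++ colours r

range1 : ℕ → List ℕ
range1 n = map suc (upTo n)

elemᵇ : ℕ → List ℕ → Bool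
elemᵇ i xs = any (λ x → i ≡ᵇ x) xs

countᵇ : ℕ → List ℕ → ℕ
countᵇ c [] = 0
countᵇ c (x ∷ xs) with c ≡ᵇ x
... | true  = suc (countᵇ c xs)
... | false = countᵇ c xs

-- leaves are labelled bijectively by [n]
labelledOn : ℕ → Tree → Bool
labelledOn n t = (length (leaves t) ≡ᵇ n) ∧ all (λ i → elemᵇ i (leaves t)) (range1 n)

positiveColours : Tree → Bool
positiveColours t = all (λ c → 0 <ᵇ c) (colours t)

-- μ(j) for j ≥ 1, where a weak composition μ = (μ(1),…,μ(k)) is a list;
-- μ(j) = 0 for j > k.
μat : List ℕ → ℕ → ℕ
μat [] j = 0
μat (m ∷ μ) zero = 0          -- index 0 is not a colour
μat (m ∷ μ) (suc zero) = m
μat (m ∷ μ) (suc (suc j)) = μat μ (suc j)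

-- exactly μ(j) internal nodes of colour j, for every j ∈ ℙ
-- (all colours are positive and at most length μ, and the counts agree)
colourCount : List ℕ → Tree → Bool
colourCount μ t =
  all (λ c → c <ᵇ suc (length μ)) (colours t) ∧
  all (λ j → countᵇ j (colours t) ≡ᵇ μat μ j) (range1 (length μ))

v : Tree → ℕ
v (leaf i) = i
v (node c l r) = v l ⊓ v r

colour : Tree → ℕ
colour (leaf i) = 0
colour (node c l r) = c

normalized : Tree → Bool
normalized (leaf i) = true
normalized (node c l r) = (v (node c l r) ≡ᵇ v l) ∧ normalized l ∧ normalized r

isLyndonNode : Tree → Bool
isLyndonNode (leaf i) = false
isLyndonNode (node c (leaf i) r) = true
isLyndonNode (node c (node c' ll lr) r) = v r <ᵇ v lr

lyndonColourCond : Tree → Bool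
lyndonColourCond (leaf i) = true
lyndonColourCond (node c l r) =
  (isLyndonNode (node c l r) ∨ (c <ᵇ colour l)) ∧ lyndonColourCond l ∧ lyndonColourCond r

combColourCond : Tree → Bool
combColourCond (leaf i) = true
combColourCond (node c l (leaf i)) = combColourCond l
combColourCond (node c l (node c' rl rr)) =
  (c' <ᵇ c) ∧ combColourCond l ∧ combColourCond (node c' rl rr)

labelledColoured : ℕ → List ℕ → Tree → Bool
labelledColoured n μ t = labelledOn n t ∧ positiveColours t ∧ colourCount μ t

isColouredLyndon : ℕ → List ℕ → Tree → Bool
isColouredLyndon n μ t = labelledColoured n μ t ∧ normalized t ∧ lyndonColourCond t

isColouredComb : ℕ → List ℕ → Tree → Bool
isColouredComb n μ t = labelledColoured n μ t ∧ normalized t ∧ combColourCond t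

-- Lyn_μ and Comb_μ (membership is a Bool-valued predicate, so these are
-- genuinely subsets of Tree)
Lyn : ℕ → List ℕ → Set
Lyn n μ = Σ Tree (λ t → T (isColouredLyndon n μ t))

Comb : ℕ → List ℕ → Set
Comb n μ = Σ Tree (λ t → T (isColouredComb n μ t))

module Submission where

-- Both families are images of one construction.  A binary tree is rebuilt
-- bottom-up by replacing every internal node `node c l r` with an insertion
-- operator applied to the rebuilt children:
--   * graftComb c X Y   descends the left spine of Y past every node of
--     colour ≥ c and puts a node of colour c there, with X on its left; the
--     result is a comb whenever X and Y are;
--   * graftLyndon c A B descends the right spine of A until the new node of
--     colour c above B is a Lyndon node or has a left child of larger colour;
--     the result satisfies the Lyndon colour condition whenever A and B do.
-- Both operators merely rebracket: they keep the leaf word, the valency and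
-- the multiset of colours, and preserve normalization; so the two rebuilding
-- maps `comb` and `lyndon` preserve everything in `labelledColoured`.
-- Two exchange laws (graftComb is associative in a suitable sense,
-- graftLyndon commutes past itself) show that `comb` turns graftLyndon into
-- graftComb and `lyndon` turns graftComb into graftLyndon.  Since each
-- operator is the identity on trees already satisfying its local condition,
-- `lyndon ∘ comb` fixes colored Lyndon trees and `comb ∘ lyndon` fixes
-- colored combs.

open import Defs
open import Data.Bool using (Bool; true; false; _∧_; _∨_; T; if_then_else_)
open import Data.Bool.Properties using (T-∧; T-irrelevant; ∧-assoc; ∧-comm)
open import Data.Bool.ListAction using (all)
open import Data.Nat using (ℕ; suc; _⊓_; _<ᵇ_; _≡ᵇ_; _≤_; _∸_)
open import Data.Nat.Properties
  using (≤-trans; ≤-reflexive; ≮⇒≥; <⇒≱; <⇒<ᵇ; <ᵇ⇒<; ≡ᵇ⇒≡; ≡⇒≡ᵇ;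
         ⊓-assoc; ⊓-glb; m⊓n≤n; m⊓n≡m⇒m≤n; m≤n⇒m⊓n≡m)
open import Data.Nat.ListAction using (sum)
open import Data.List using (List; []; _∷_; _++_; length)
open import Data.List.Properties using (++-assoc)
open import Data.List.Relation.Binary.Permutation.Propositional
  using (_↭_; ↭-refl; ↭-sym; ↭-trans; ↭-reflexive; prep; swap)
import Data.List.Relation.Binary.Permutation.Propositional as Perm
open import Data.List.Relation.Binary.Permutation.Propositional.Properties
  using (shift; ++⁺ˡ; ++⁺ʳ)
open import Data.Product using (Σ; _×_; _,_; proj₁; proj₂)
open import Data.Unit using (tt)
open import Data.Empty using (⊥-elim)
open import Function.Bundles using (Equivalence; _⤖_; mk↔ₛ′)
open import Function.Properties.Inverse using (↔⇒⤖)
open import Relation.Binary.PropositionalEquality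
  using (_≡_; refl; sym; trans; cong; cong₂; subst; subst₂; module ≡-Reasoning)

module _ {A B : Set} (f : List A → B) (step : A → B → B)
         (f-cons : ∀ x xs → f (x ∷ xs) ≡ step x (f xs))
         (step-comm : ∀ x y b → step x (step y b) ≡ step y (step x b)) where

  ↭-invariant : ∀ {xs ys} → xs ↭ ys → f xs ≡ f ys
  ↭-invariant Perm.refl = refl
  ↭-invariant (prep {xs} {ys} x p) = begin
    f (x ∷ xs)      ≡⟨ f-cons x xs ⟩
    step x (f xs)   ≡⟨ cong (step x) (↭-invariant p) ⟩
    step x (f ys)   ≡⟨ sym (f-cons x ys) ⟩
    f (x ∷ ys)      ∎
    where open ≡-Reasoning
  ↭-invariant (swap {xs} {ys} x y p) = begin
    f (x ∷ y ∷ xs)             ≡⟨ trans (f-cons x _) (cong (step x) (f-cons y xs)) ⟩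
    step x (step y (f xs))     ≡⟨ cong (λ b → step x (step y b)) (↭-invariant p) ⟩
    step x (step y (f ys))     ≡⟨ step-comm x y (f ys) ⟩
    step y (step x (f ys))     ≡⟨ sym (trans (f-cons y _) (cong (step y) (f-cons x ys))) ⟩
    f (y ∷ x ∷ ys)             ∎
    where open ≡-Reasoning
  ↭-invariant (Perm.trans p q) = trans (↭-invariant p) (↭-invariant q)

all-↭ : ∀ {A : Set} (p : A → Bool) {xs ys} → xs ↭ ys → all p xs ≡ all p ys
all-↭ p = ↭-invariant (all p) (λ x b → p x ∧ b) (λ _ _ → refl) ∧-leftComm
  where
  ∧-leftComm : ∀ x y b → p x ∧ (p y ∧ b) ≡ p y ∧ (p x ∧ b)
  ∧-leftComm x y b = begin
    p x ∧ (p y ∧ b)   ≡⟨ sym (∧-assoc (p x) (p y) b) ⟩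
    (p x ∧ p y) ∧ b   ≡⟨ cong (_∧ b) (∧-comm (p x) (p y)) ⟩
    (p y ∧ p x) ∧ b   ≡⟨ ∧-assoc (p y) (p x) b ⟩
    p y ∧ (p x ∧ b)   ∎
    where open ≡-Reasoning

count-↭ : ∀ j {xs ys} → xs ↭ ys → countᵇ j xs ≡ countᵇ j ys
count-↭ j = ↭-invariant (countᵇ j) countStep count-cons countStep-comm
  where
  countStep : ℕ → ℕ → ℕ
  countStep x m = if j ≡ᵇ x then suc m else m

  count-cons : ∀ x xs → countᵇ j (x ∷ xs) ≡ countStep x (countᵇ j xs)
  count-cons x xs with j ≡ᵇ x
  ... | true  = refl
  ... | false = refl

  countStep-comm : ∀ x y m → countStep x (countStep y m) ≡ countStep y (countStep x m)
  countStep-comm x y m with j ≡ᵇ x | j ≡ᵇ y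
  ... | true  | true  = refl
  ... | true  | false = refl
  ... | false | true  = refl
  ... | false | false = refl

-- The colour list of a tree after one rotation is a permutation of the
-- original one.
rotate-↭ : ∀ (a b : ℕ) xs ys zs → a ∷ (b ∷ xs ++ ys) ++ zs ↭ b ∷ xs ++ (a ∷ ys ++ zs)
rotate-↭ a b xs ys zs =
  ↭-trans (prep a (↭-reflexive (cong (b ∷_) (++-assoc xs ys zs))))
          (↭-trans (swap a b ↭-refl) (prep b (↭-sym (shift a xs (ys ++ zs)))))

labelledColoured-resp : ∀ n μ t t' → leaves t ≡ leaves t' → colours t ↭ colours t' →
  labelledColoured n μ t ≡ labelledColoured n μ t'
labelledColoured-resp n μ t t' sameLeaves sameColours =
  cong₂ _∧_
    (cong (λ ls → (length ls ≡ᵇ n) ∧ all (λ i → elemᵇ i ls) (range1 n)) sameLeaves)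
    (cong₂ _∧_ (all-↭ (λ c → 0 <ᵇ c) sameColours)
      (cong₂ _∧_ (all-↭ (λ c → c <ᵇ suc (length μ)) sameColours)
                 (all-cong (range1 (length μ))
                   (λ j → cong (_≡ᵇ μat μ j) (count-↭ j sameColours)))))
  where
  all-cong : ∀ {f g : ℕ → Bool} xs → (∀ x → f x ≡ g x) → all f xs ≡ all g xs
  all-cong []       f≗g = refl
  all-cong (x ∷ xs) f≗g = cong₂ _∧_ (f≗g x) (all-cong xs f≗g)

∧-intro : ∀ {a b} → T a → T b → T (a ∧ b)
∧-intro p q = Equivalence.from T-∧ (p , q)

∧-split3 : ∀ {a b c} → T (a ∧ b ∧ c) → T a × T b × T c
∧-split3 p with Equivalence.to T-∧ p
... | pa , pbc = pa , Equivalence.to T-∧ pbc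

T-≡true : ∀ {b} → b ≡ true → T b
T-≡true refl = tt

∨-false : ∀ a b → (a ∨ b) ≡ false → (a ≡ false) × (b ≡ false)
∨-false false false refl = refl , refl

<ᵇ-false⇒≥ : ∀ {m n} → (m <ᵇ n) ≡ false → n ≤ m
<ᵇ-false⇒≥ e = ≮⇒≥ (λ m<n → subst T e (<⇒<ᵇ m<n))

≥⇒<ᵇ-false : ∀ {m n} → n ≤ m → (m <ᵇ n) ≡ false
≥⇒<ᵇ-false {m} {n} n≤m with m <ᵇ n in e
... | false = refl
... | true  = ⊥-elim (<⇒≱ (<ᵇ⇒< m n (T-≡true e)) n≤m)

subtree-≡ : ∀ {P : Tree → Bool} {x y : Σ Tree (λ t → T (P t))} → proj₁ x ≡ proj₁ y → x ≡ y
subtree-≡ {x = t , p} {y = .t , q} refl = cong (t ,_) (T-irrelevant p q)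

graftComb : ℕ → Tree → Tree → Tree
graftComb c X (leaf i) = node c X (leaf i)
graftComb c X (node c' Y₁ Y₂) with c' <ᵇ c
... | true  = node c X (node c' Y₁ Y₂)
... | false = node c' (graftComb c X Y₁) Y₂

graftLyndon : ℕ → Tree → Tree → Tree
graftLyndon c (leaf i) B = node c (leaf i) B
graftLyndon c (node c₀ A₁ A₂) B with (v B <ᵇ v A₂) ∨ (c <ᵇ c₀)
... | true  = node c (node c₀ A₁ A₂) B
... | false = node c₀ A₁ (graftLyndon c A₂ B)

leaves-graftComb : ∀ c X Y → leaves (graftComb c X Y) ≡ leaves X ++ leaves Y
leaves-graftComb c X (leaf i) = refl
leaves-graftComb c X (node c' Y₁ Y₂) with c' <ᵇ c
... | true  = refl
... | false = trans (cong (_++ leaves Y₂) (leaves-graftComb c X Y₁))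
                    (++-assoc (leaves X) (leaves Y₁) (leaves Y₂))

leaves-graftLyndon : ∀ c A B → leaves (graftLyndon c A B) ≡ leaves A ++ leaves B
leaves-graftLyndon c (leaf i) B = refl
leaves-graftLyndon c (node c₀ A₁ A₂) B with (v B <ᵇ v A₂) ∨ (c <ᵇ c₀)
... | true  = refl
... | false = trans (cong (leaves A₁ ++_) (leaves-graftLyndon c A₂ B))
                    (sym (++-assoc (leaves A₁) (leaves A₂) (leaves B)))

v-graftComb : ∀ c X Y → v (graftComb c X Y) ≡ v X ⊓ v Y
v-graftComb c X (leaf i) = refl
v-graftComb c X (node c' Y₁ Y₂) with c' <ᵇ c
... | true  = refl
... | false = trans (cong (_⊓ v Y₂) (v-graftComb c X Y₁)) (⊓-assoc (v X) (v Y₁) (v Y₂))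

v-graftLyndon : ∀ c A B → v (graftLyndon c A B) ≡ v A ⊓ v B
v-graftLyndon c (leaf i) B = refl
v-graftLyndon c (node c₀ A₁ A₂) B with (v B <ᵇ v A₂) ∨ (c <ᵇ c₀)
... | true  = refl
... | false = trans (cong (v A₁ ⊓_) (v-graftLyndon c A₂ B)) (sym (⊓-assoc (v A₁) (v A₂) (v B)))

v-graftLyndon-≤ : ∀ c A B → v A ≤ v B → v (graftLyndon c A B) ≡ v A
v-graftLyndon-≤ c A B vA≤vB = trans (v-graftLyndon c A B) (m≤n⇒m⊓n≡m vA≤vB)

colours-graftComb : ∀ c X Y → colours (graftComb c X Y) ↭ c ∷ colours X ++ colours Y
colours-graftComb c X (leaf i) = ↭-refl
colours-graftComb c X (node c' Y₁ Y₂) with c' <ᵇ c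
... | true  = ↭-refl
... | false = ↭-trans (prep c' (++⁺ʳ (colours Y₂) (colours-graftComb c X Y₁)))
                      (rotate-↭ c' c (colours X) (colours Y₁) (colours Y₂))

colours-graftLyndon : ∀ c A B → colours (graftLyndon c A B) ↭ c ∷ colours A ++ colours B
colours-graftLyndon c (leaf i) B = ↭-refl
colours-graftLyndon c (node c₀ A₁ A₂) B with (v B <ᵇ v A₂) ∨ (c <ᵇ c₀)
... | true  = ↭-refl
... | false = ↭-trans (prep c₀ (++⁺ˡ (colours A₁) (colours-graftLyndon c A₂ B)))
                      (↭-sym (rotate-↭ c c₀ (colours A₁) (colours A₂) (colours B)))

normalized-node⁻ : ∀ c l r → T (normalized (node c l r)) →
  v l ≤ v r × T (normalized l) × T (normalized r)
normalized-node⁻ c l r p with ∧-split3 p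
... | vEq , nl , nr = m⊓n≡m⇒m≤n (≡ᵇ⇒≡ _ _ vEq) , nl , nr

normalized-node⁺ : ∀ c l r → v l ≤ v r → T (normalized l) → T (normalized r) →
  T (normalized (node c l r))
normalized-node⁺ c l r vl≤vr nl nr = ∧-intro (≡⇒≡ᵇ _ _ (m≤n⇒m⊓n≡m vl≤vr)) (∧-intro nl nr)

normalized-graftComb : ∀ c X Y → T (normalized X) → T (normalized Y) → v X ≤ v Y →
  T (normalized (graftComb c X Y))
normalized-graftComb c X (leaf i) nX nY le = normalized-node⁺ c X (leaf i) le nX tt
normalized-graftComb c X (node c' Y₁ Y₂) nX nY le with c' <ᵇ c
... | true  = normalized-node⁺ c X (node c' Y₁ Y₂) le nX nY
... | false with normalized-node⁻ c' Y₁ Y₂ nY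
... | v₁≤v₂ , n₁ , n₂ = normalized-node⁺ c' (graftComb c X Y₁) Y₂ left≤right
                          (normalized-graftComb c X Y₁ nX n₁ vX≤v₁) n₂
  where
  vX≤v₁ : v X ≤ v Y₁
  vX≤v₁ = ≤-trans le (≤-reflexive (m≤n⇒m⊓n≡m v₁≤v₂))
  left≤right : v (graftComb c X Y₁) ≤ v Y₂
  left≤right = subst (_≤ v Y₂) (sym (v-graftComb c X Y₁)) (≤-trans (m⊓n≤n (v X) (v Y₁)) v₁≤v₂)

normalized-graftLyndon : ∀ c A B → T (normalized A) → T (normalized B) → v A ≤ v B →
  T (normalized (graftLyndon c A B))
normalized-graftLyndon c (leaf i) B nA nB le = normalized-node⁺ c (leaf i) B le tt nB
normalized-graftLyndon c (node c₀ A₁ A₂) B nA nB le with (v B <ᵇ v A₂) ∨ (c <ᵇ c₀) in e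
... | true  = normalized-node⁺ c (node c₀ A₁ A₂) B le nA nB
... | false with normalized-node⁻ c₀ A₁ A₂ nA
... | v₁≤v₂ , n₁ , n₂ = normalized-node⁺ c₀ A₁ (graftLyndon c A₂ B) left≤right n₁
                          (normalized-graftLyndon c A₂ B n₂ nB v₂≤vB)
  where
  v₂≤vB : v A₂ ≤ v B
  v₂≤vB = <ᵇ-false⇒≥ (proj₁ (∨-false _ _ e))
  left≤right : v A₁ ≤ v (graftLyndon c A₂ B)
  left≤right = subst (v A₁ ≤_) (sym (v-graftLyndon c A₂ B))
    (⊓-glb v₁≤v₂ (≤-trans (≤-reflexive (sym (m≤n⇒m⊓n≡m v₁≤v₂))) le))

module Rebuild (graft : ℕ → Tree → Tree → Tree)
               (leaves-graft : ∀ c X Y → leaves (graft c X Y) ≡ leaves X ++ leaves Y)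
               (v-graft : ∀ c X Y → v (graft c X Y) ≡ v X ⊓ v Y)
               (colours-graft : ∀ c X Y → colours (graft c X Y) ↭ c ∷ colours X ++ colours Y)
               (normalized-graft : ∀ c X Y → T (normalized X) → T (normalized Y) → v X ≤ v Y →
                                     T (normalized (graft c X Y)))
               where

  rebuild : Tree → Tree
  rebuild (leaf i)     = leaf i
  rebuild (node c l r) = graft c (rebuild l) (rebuild r)

  leaves-rebuild : ∀ t → leaves (rebuild t) ≡ leaves t
  leaves-rebuild (leaf i)     = refl
  leaves-rebuild (node c l r) =
    trans (leaves-graft c _ _) (cong₂ _++_ (leaves-rebuild l) (leaves-rebuild r))

  v-rebuild : ∀ t → v (rebuild t) ≡ v t
  v-rebuild (leaf i)     = refl
  v-rebuild (node c l r) = trans (v-graft c _ _) (cong₂ _⊓_ (v-rebuild l) (v-rebuild r))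

  colours-rebuild : ∀ t → colours (rebuild t) ↭ colours t
  colours-rebuild (leaf i)     = ↭-refl
  colours-rebuild (node c l r) = ↭-trans (colours-graft c _ _)
    (prep c (↭-trans (++⁺ʳ _ (colours-rebuild l)) (++⁺ˡ (colours l) (colours-rebuild r))))

  labelledColoured-rebuild : ∀ n μ t → T (labelledColoured n μ t) → T (labelledColoured n μ (rebuild t))
  labelledColoured-rebuild n μ t =
    subst T (labelledColoured-resp n μ t (rebuild t)
              (sym (leaves-rebuild t)) (↭-sym (colours-rebuild t)))

  normalized-rebuild : ∀ t → T (normalized t) → T (normalized (rebuild t))
  normalized-rebuild (leaf i)     _ = tt
  normalized-rebuild (node c l r) p with normalized-node⁻ c l r p
  ... | vl≤vr , nl , nr = normalized-graft c _ _ (normalized-rebuild l nl) (normalized-rebuild r nr)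
          (subst₂ _≤_ (sym (v-rebuild l)) (sym (v-rebuild r)) vl≤vr)

open Rebuild graftComb leaves-graftComb v-graftComb colours-graftComb normalized-graftComb
  using () renaming (rebuild to comb;
                     labelledColoured-rebuild to labelledColoured-comb;
                     normalized-rebuild to normalized-comb)
open Rebuild graftLyndon leaves-graftLyndon v-graftLyndon colours-graftLyndon
             normalized-graftLyndon
  using () renaming (rebuild to lyndon; v-rebuild to v-lyndon;
                     labelledColoured-rebuild to labelledColoured-lyndon;
                     normalized-rebuild to normalized-lyndon)

graftComb-descend : ∀ c X c' Y₁ Y₂ → c ≤ c' →
  graftComb c X (node c' Y₁ Y₂) ≡ node c' (graftComb c X Y₁) Y₂
graftComb-descend c X c' Y₁ Y₂ c≤c' rewrite ≥⇒<ᵇ-false c≤c' = refl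

graftLyndon-descend : ∀ c c₀ A₁ A₂ B → v A₂ ≤ v B → c₀ ≤ c →
  graftLyndon c (node c₀ A₁ A₂) B ≡ node c₀ A₁ (graftLyndon c A₂ B)
graftLyndon-descend c c₀ A₁ A₂ B vA₂≤vB c₀≤c
  rewrite ≥⇒<ᵇ-false vA₂≤vB | ≥⇒<ᵇ-false c₀≤c = refl

graftLyndon-stop : ∀ c c₀ A₁ A₂ B → ((v B <ᵇ v A₂) ∨ (c <ᵇ c₀)) ≡ true →
  graftLyndon c (node c₀ A₁ A₂) B ≡ node c (node c₀ A₁ A₂) B
graftLyndon-stop c c₀ A₁ A₂ B stops rewrite stops = refl

combColourCond-children : ∀ c L R → T (combColourCond (node c L R)) →
  T (combColourCond L) × T (combColourCond R)
combColourCond-children c L (leaf i) p = p , tt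
combColourCond-children c L (node c' R₁ R₂) p with ∧-split3 {c' <ᵇ c} p
... | _ , pL , pR = pL , pR

-- Left children are unconstrained by their parent, so they may be replaced.
combColourCond-replaceˡ : ∀ c L L' R → T (combColourCond (node c L R)) →
  T (combColourCond L') → T (combColourCond (node c L' R))
combColourCond-replaceˡ c L L' (leaf i) p q = q
combColourCond-replaceˡ c L L' (node c' R₁ R₂) p q with ∧-split3 {c' <ᵇ c} p
... | c'<c , _ , pR = ∧-intro c'<c (∧-intro q pR)

-- Comb insertion of two combs is a comb: the inserted node sits above a node
-- of smaller colour, and everything below it is unchanged.
combColourCond-graftComb : ∀ c X Y → T (combColourCond X) → T (combColourCond Y) →
  T (combColourCond (graftComb c X Y))
combColourCond-graftComb c X (leaf i) pX pY = pX
combColourCond-graftComb c X (node c' Y₁ Y₂) pX pY with c' <ᵇ c in e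
... | true  = ∧-intro (T-≡true e) (∧-intro pX pY)
... | false = combColourCond-replaceˡ c' Y₁ (graftComb c X Y₁) Y₂ pY
                (combColourCond-graftComb c X Y₁ pX (proj₁ (combColourCond-children c' Y₁ Y₂ pY)))

combColourCond-comb : ∀ t → T (combColourCond (comb t))
combColourCond-comb (leaf i)     = tt
combColourCond-comb (node c l r) =
  combColourCond-graftComb c (comb l) (comb r) (combColourCond-comb l) (combColourCond-comb r)

isLyndonNode-resp-v : ∀ c A₁ X X' → v X ≡ v X' →
  isLyndonNode (node c A₁ X) ≡ isLyndonNode (node c A₁ X')
isLyndonNode-resp-v c (leaf i)        X X' vX≡vX' = refl
isLyndonNode-resp-v c (node _ _ A₁₂) X X' vX≡vX' = cong (_<ᵇ v A₁₂) vX≡vX'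

-- Lyndon insertion preserves the Lyndon colour condition: at the stopping
-- place it holds by construction, and the nodes passed on the way down keep
-- the valency of their right child.
lyndonColourCond-graftLyndon : ∀ c A B → T (lyndonColourCond A) → T (lyndonColourCond B) →
  T (lyndonColourCond (graftLyndon c A B))
lyndonColourCond-graftLyndon c (leaf i) B pA pB = ∧-intro tt (∧-intro tt pB)
lyndonColourCond-graftLyndon c (node c₀ A₁ A₂) B pA pB with (v B <ᵇ v A₂) ∨ (c <ᵇ c₀) in e
... | true  = ∧-intro (T-≡true e) (∧-intro pA pB)
... | false with ∧-split3 {isLyndonNode (node c₀ A₁ A₂) ∨ (c₀ <ᵇ colour A₁)} pA
... | rootCond , p₁ , p₂ =
  ∧-intro (subst (λ b → T (b ∨ (c₀ <ᵇ colour A₁))) (isLyndonNode-resp-v c₀ A₁ A₂ _ (sym vKept)) rootCond)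
          (∧-intro p₁ (lyndonColourCond-graftLyndon c A₂ B p₂ pB))
  where
  vKept : v (graftLyndon c A₂ B) ≡ v A₂
  vKept = v-graftLyndon-≤ c A₂ B (<ᵇ-false⇒≥ (proj₁ (∨-false _ _ e)))

lyndonColourCond-lyndon : ∀ t → T (lyndonColourCond (lyndon t))
lyndonColourCond-lyndon (leaf i)     = tt
lyndonColourCond-lyndon (node c l r) =
  lyndonColourCond-graftLyndon c (lyndon l) (lyndon r)
    (lyndonColourCond-lyndon l) (lyndonColourCond-lyndon r)

graftComb-assoc : ∀ c₀ c X Y Z → c₀ ≤ c →
  graftComb c (graftComb c₀ X Y) Z ≡ graftComb c₀ X (graftComb c Y Z)
graftComb-assoc c₀ c X Y (leaf i) c₀≤c =
  sym (graftComb-descend c₀ X c Y (leaf i) c₀≤c)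
graftComb-assoc c₀ c X Y (node z Z₁ Z₂) c₀≤c with z <ᵇ c in e
... | true  = sym (graftComb-descend c₀ X c Y (node z Z₁ Z₂) c₀≤c)
... | false = begin
  node z (graftComb c (graftComb c₀ X Y) Z₁) Z₂ ≡⟨ cong (λ t → node z t Z₂) (graftComb-assoc c₀ c X Y Z₁ c₀≤c) ⟩
  node z (graftComb c₀ X (graftComb c Y Z₁)) Z₂ ≡⟨ sym (graftComb-descend c₀ X z _ Z₂ (≤-trans c₀≤c (<ᵇ-false⇒≥ e))) ⟩
  graftComb c₀ X (node z (graftComb c Y Z₁) Z₂) ∎
  where open ≡-Reasoning

graftLyndon-exchange : ∀ c c' A B C → c ≤ c' → v B ≤ v C →
  graftLyndon c' (graftLyndon c A B) C ≡ graftLyndon c A (graftLyndon c' B C)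
graftLyndon-exchange c c' (leaf i) B C c≤c' vB≤vC = graftLyndon-descend c' c (leaf i) B C vB≤vC c≤c'
graftLyndon-exchange c c' (node a A₁ A₂) B C c≤c' vB≤vC with (v B <ᵇ v A₂) ∨ (c <ᵇ a) in e
... | true  = begin
  graftLyndon c' (node c (node a A₁ A₂) B) C  ≡⟨ graftLyndon-descend c' c _ B C vB≤vC c≤c' ⟩
  node c (node a A₁ A₂) (graftLyndon c' B C)  ≡⟨ sym (graftLyndon-stop c a A₁ A₂ _ (trans stopCond e)) ⟩
  graftLyndon c (node a A₁ A₂) (graftLyndon c' B C) ∎
  where
  open ≡-Reasoning
  stopCond : ((v (graftLyndon c' B C) <ᵇ v A₂) ∨ (c <ᵇ a)) ≡ ((v B <ᵇ v A₂) ∨ (c <ᵇ a))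
  stopCond = cong (λ x → (x <ᵇ v A₂) ∨ (c <ᵇ a)) (v-graftLyndon-≤ c' B C vB≤vC)
... | false = begin
  graftLyndon c' (node a A₁ (graftLyndon c A₂ B)) C   ≡⟨ graftLyndon-descend c' a A₁ _ C vA₂B≤vC (≤-trans a≤c c≤c') ⟩
  node a A₁ (graftLyndon c' (graftLyndon c A₂ B) C)   ≡⟨ cong (node a A₁) (graftLyndon-exchange c c' A₂ B C c≤c' vB≤vC) ⟩
  node a A₁ (graftLyndon c A₂ (graftLyndon c' B C))   ≡⟨ sym (graftLyndon-descend c a A₁ A₂ _ vA₂≤vBC a≤c) ⟩
  graftLyndon c (node a A₁ A₂) (graftLyndon c' B C)   ∎
  where
  open ≡-Reasoning
  vA₂≤vB : v A₂ ≤ v B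
  vA₂≤vB = <ᵇ-false⇒≥ (proj₁ (∨-false _ _ e))
  a≤c : a ≤ c
  a≤c = <ᵇ-false⇒≥ (proj₂ (∨-false _ _ e))
  vA₂B≤vC : v (graftLyndon c A₂ B) ≤ v C
  vA₂B≤vC = ≤-trans (≤-reflexive (v-graftLyndon c A₂ B)) (≤-trans (m⊓n≤n (v A₂) (v B)) vB≤vC)
  vA₂≤vBC : v A₂ ≤ v (graftLyndon c' B C)
  vA₂≤vBC = ≤-trans vA₂≤vB (≤-reflexive (sym (v-graftLyndon-≤ c' B C vB≤vC)))

comb-graftLyndon : ∀ c A B → comb (graftLyndon c A B) ≡ graftComb c (comb A) (comb B)
comb-graftLyndon c (leaf i) B = refl
comb-graftLyndon c (node c₀ A₁ A₂) B with (v B <ᵇ v A₂) ∨ (c <ᵇ c₀) in e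
... | true  = refl
... | false = begin
  graftComb c₀ (comb A₁) (comb (graftLyndon c A₂ B))      ≡⟨ cong (graftComb c₀ (comb A₁)) (comb-graftLyndon c A₂ B) ⟩
  graftComb c₀ (comb A₁) (graftComb c (comb A₂) (comb B)) ≡⟨ sym (graftComb-assoc c₀ c (comb A₁) (comb A₂) (comb B) c₀≤c) ⟩
  graftComb c (graftComb c₀ (comb A₁) (comb A₂)) (comb B) ∎
  where
  open ≡-Reasoning
  c₀≤c : c₀ ≤ c
  c₀≤c = <ᵇ-false⇒≥ (proj₂ (∨-false _ _ e))

lyndon-graftComb : ∀ c X Y → T (normalized Y) →
  lyndon (graftComb c X Y) ≡ graftLyndon c (lyndon X) (lyndon Y)
lyndon-graftComb c X (leaf i) nY = refl
lyndon-graftComb c X (node c' Y₁ Y₂) nY with c' <ᵇ c in e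
... | true  = refl
... | false with normalized-node⁻ c' Y₁ Y₂ nY
... | vY₁≤vY₂ , nY₁ , _ = begin
  graftLyndon c' (lyndon (graftComb c X Y₁)) (lyndon Y₂)             ≡⟨ cong (λ t → graftLyndon c' t (lyndon Y₂)) (lyndon-graftComb c X Y₁ nY₁) ⟩
  graftLyndon c' (graftLyndon c (lyndon X) (lyndon Y₁)) (lyndon Y₂) ≡⟨ graftLyndon-exchange c c' (lyndon X) (lyndon Y₁) (lyndon Y₂) (<ᵇ-false⇒≥ e) vY≤ ⟩
  graftLyndon c (lyndon X) (graftLyndon c' (lyndon Y₁) (lyndon Y₂)) ∎
  where
  open ≡-Reasoning
  vY≤ : v (lyndon Y₁) ≤ v (lyndon Y₂)
  vY≤ = subst₂ _≤_ (sym (v-lyndon Y₁)) (sym (v-lyndon Y₂)) vY₁≤vY₂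

graftLyndon-id : ∀ c L R → T (isLyndonNode (node c L R) ∨ (c <ᵇ colour L)) →
  graftLyndon c L R ≡ node c L R
graftLyndon-id c (leaf i) R h = refl
graftLyndon-id c (node c₀ A₁ A₂) R h with (v R <ᵇ v A₂) ∨ (c <ᵇ c₀)
... | true  = refl
... | false = ⊥-elim h

graftComb-id : ∀ c L R → T (combColourCond (node c L R)) → graftComb c L R ≡ node c L R
graftComb-id c L (leaf i) h = refl
graftComb-id c L (node c' R₁ R₂) h with c' <ᵇ c
... | true  = refl
... | false = ⊥-elim h

-- Rebuilding node by node, the exchange laws reduce both round trips to the
-- fixed-point lemmas above.
lyndon-comb : ∀ t → T (normalized t) → T (lyndonColourCond t) → lyndon (comb t) ≡ t
lyndon-comb (leaf i) _ _ = refl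
lyndon-comb (node c L R) n p with normalized-node⁻ c L R n
... | _ , nL , nR with ∧-split3 {isLyndonNode (node c L R) ∨ (c <ᵇ colour L)} p
... | rootCond , pL , pR = begin
  lyndon (graftComb c (comb L) (comb R))               ≡⟨ lyndon-graftComb c (comb L) (comb R) (normalized-comb R nR) ⟩
  graftLyndon c (lyndon (comb L)) (lyndon (comb R))    ≡⟨ cong₂ (graftLyndon c) (lyndon-comb L nL pL) (lyndon-comb R nR pR) ⟩
  graftLyndon c L R                                    ≡⟨ graftLyndon-id c L R rootCond ⟩
  node c L R ∎
  where open ≡-Reasoning

comb-lyndon : ∀ t → T (combColourCond t) → comb (lyndon t) ≡ t
comb-lyndon (leaf i) _ = refl
comb-lyndon (node c L R) p with combColourCond-children c L R p
... | pL , pR = begin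
  comb (graftLyndon c (lyndon L) (lyndon R))           ≡⟨ comb-graftLyndon c (lyndon L) (lyndon R) ⟩
  graftComb c (comb (lyndon L)) (comb (lyndon R))      ≡⟨ cong₂ (graftComb c) (comb-lyndon L pL) (comb-lyndon R pR) ⟩
  graftComb c L R                                      ≡⟨ graftComb-id c L R p ⟩
  node c L R ∎
  where open ≡-Reasoning

lynToComb : ∀ n μ → Lyn n μ → Comb n μ
lynToComb n μ (t , p) with ∧-split3 {labelledColoured n μ t} p
... | lc , nt , _ =
  comb t , ∧-intro (labelledColoured-comb n μ t lc) (∧-intro (normalized-comb t nt) (combColourCond-comb t))

combToLyn : ∀ n μ → Comb n μ → Lyn n μ
combToLyn n μ (t , p) with ∧-split3 {labelledColoured n μ t} p
... | lc , nt , _ =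
  lyndon t , ∧-intro (labelledColoured-lyndon n μ t lc) (∧-intro (normalized-lyndon t nt) (lyndonColourCond-lyndon t))

theorem5p4 : (n : ℕ) → 1 ≤ n → (μ : List ℕ) → sum μ ≡ n ∸ 1 →
    Lyn n μ ⤖ Comb n μ
theorem5p4 n _ μ _ = ↔⇒⤖ (mk↔ₛ′ (lynToComb n μ) (combToLyn n μ) combToLyn-inverse lynToComb-inverse)
  where
  combToLyn-inverse : ∀ y → lynToComb n μ (combToLyn n μ y) ≡ y
  combToLyn-inverse (t , p) with ∧-split3 {labelledColoured n μ t} p
  ... | _ , _ , pc = subtree-≡ {P = isColouredComb n μ} (comb-lyndon t pc)

  lynToComb-inverse : ∀ x → combToLyn n μ (lynToComb n μ x) ≡ x
  lynToComb-inverse (t , p) with ∧-split3 {labelledColoured n μ t} p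
  ... | _ , nt , pl = subtree-≡ {P = isColouredLyndon n μ} (lyndon-comb t nt pl)
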